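{- Let $n\ge 2$ and let $C_{2n}$ be the cycle on $2n$ vertices. If $A$ is a center set of $C_{2n}$, then either $|A|\le\lfloor 4n/3\rfloor$ or $|A|=2n$.
   Context: $d$ is shortest-path distance. For nonempty $S\subseteq V$, $e_S(v)=\max_{x\in S}d(v,x)$ and $C_S(G)=\{v\in V: e_S(v)\le e_S(x)\ \forall x\in V\}$. A set $A\subseteq V$ is a center set of $G$ if $A=C_S(G)$ for some nonempty $S\subseteq V$. -}

module Defs where

open import Data.Nat using (ℕ; zero; suc; _+_; _≤_; _⊔_)
import Data.Nat as ℕ
open import Data.Bool using (Bool; true; false; _∨_; _∧_; if_then_else_)
open import Data.Fin using (Fin; toℕ)
import Data.Fin as Fin
open import Data.Fin.Subset using (Subset; _∈_; Nonempty)
open import Data.Fin.Subset.Properties using (_∈?_)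
open import Data.List using (List; foldr; allFin; filter)
open import Data.Bool.ListAction using (any)
open import Relation.Nullary.Decidable using (⌊_⌋)
open import Data.Product using (∃; _×_)
open import Function.Bundles using (_⇔_)

Graph : ℕ → Set
Graph N = Fin N → Fin N → Bool

-- The cycle C_m on vertices 0,…,m-1: i ~ j iff j = i+1 or i = j+1 (mod m)
-- (for m ≥ 3 this is the usual cycle graph).
cycleGraph : (m : ℕ) → Graph m
cycleGraph m i j =
  ⌊ toℕ j ℕ.≟ suc (toℕ i) ⌋ ∨ ⌊ toℕ i ℕ.≟ suc (toℕ j) ⌋
  ∨ (⌊ suc (toℕ i) ℕ.≟ m ⌋ ∧ ⌊ toℕ j ℕ.≟ 0 ⌋)
  ∨ (⌊ suc (toℕ j) ℕ.≟ m ⌋ ∧ ⌊ toℕ i ℕ.≟ 0 ⌋)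

reach : ∀ {N} → Graph N → ℕ → Fin N → Fin N → Bool
reach G zero    u v = ⌊ u Fin.≟ v ⌋
reach G (suc k) u v = reach G k u v ∨ any (λ w → reach G k u w ∧ G w v) (allFin _)

distFrom : ∀ {N} → Graph N → (k fuel : ℕ) → Fin N → Fin N → ℕ
distFrom G k zero       u v = k
distFrom G k (suc fuel) u v = if reach G k u v then k else distFrom G (suc k) fuel u v

-- Shortest-path distance d(u,v) (any shortest walk in an N-vertex graph has length < N;
-- for disconnected pairs this returns N, which does not occur for the cycle).
dist : ∀ {N} → Graph N → Fin N → Fin N → ℕ
dist {N} G u v = distFrom G 0 N u v

ecc : ∀ {N} → Graph N → Subset N → Fin N → ℕ
ecc G S v = foldr (λ x m → dist G v x ⊔ m) 0 (filter (_∈? S) (allFin _))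

InCenter : ∀ {N} → Graph N → Subset N → Fin N → Set
InCenter G S v = ∀ x → ecc G S v ≤ ecc G S x

IsCenterSet : ∀ {N} → Graph N → Subset N → Set
IsCenterSet G A = ∃ λ S → Nonempty S × (∀ v → (v ∈ A) ⇔ InCenter G S v)

module Submission where

open import Defs
open import Data.Bool using (Bool; true; false; T; not; _∨_; _∧_)
open import Data.Bool.ListAction using (any)
open import Data.Bool.Properties using (T-∨; T-∧; ∨-assoc; ∨-comm)
open import Data.Fin using (Fin; zero; suc; toℕ; fromℕ<)
open import Data.Fin.Properties using (toℕ<n; toℕ-fromℕ<; toℕ-injective; any?)
open import Data.Fin.Subset using (Subset; ∣_∣; Nonempty; _∉_) renaming (_∈_ to _∈ₛ_)
open import Data.Fin.Subset.Properties using (_∈?_; ⊆⊤; ⊆-antisym; ∣⊤∣≡n)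
open import Data.List using ([]; _∷_; foldr; allFin; filter)
open import Data.List.Membership.Propositional using (_∈_; lose)
open import Data.List.Membership.Propositional.Properties using (∈-allFin; ∈-filter⁺; ∈-filter⁻)
open import Data.List.Relation.Unary.Any using (here; there; satisfied)
open import Data.List.Relation.Unary.Any.Properties using (any⁺; any⁻)
open import Data.Nat
open import Data.Nat.DivMod using (m*n/n≡m; /-monoˡ-≤)
open import Data.Nat.Properties
open import Algebra.Properties.CommutativeSemigroup +-commutativeSemigroup using (interchange)
open import Data.Product using (∃-syntax; _×_; _,_; proj₂)
open import Data.Sum using (_⊎_; inj₁; inj₂)
import Data.Sum as Sum
open import Data.Vec using ([]; _∷_; here; there)
open import Function using (_∘_)
open import Function.Bundles using (_⇔_; mk⇔; Equivalence)
open import Relation.Binary.Definitions using (tri<; tri≈; tri>)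
open import Relation.Binary.PropositionalEquality
open import Relation.Nullary using (yes; no; ¬_; contradiction)
open import Relation.Nullary.Decidable using (⌊_⌋; toWitness; fromWitness)

-- On C_2n the distance between u and v is min(|u − v|, 2n − |u − v|) ≤ n, so every eccentricity
-- e_S is at most n. If e_S ≡ n everywhere, every vertex is central and |A| = 2n. Otherwise every
-- central vertex v has e_S(v) < n; stepping from v away from a point y ∈ S farthest from v
-- increases d(y, ·), so v has a neighbour of larger eccentricity, which is not central. Hence
-- every vertex of A has a neighbour outside A; charging each vertex of A to such a neighbour
-- charges every vertex outside A at most twice, so |A| ≤ 2(2n − |A|), i.e. 3|A| ≤ 4n.

m∸n≤1+m∸[1+n] : ∀ m n → m ∸ n ≤ suc (m ∸ suc n)
m∸n≤1+m∸[1+n] zero    n       = subst (_≤ 1) (sym (0∸n≡0 n)) z≤n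
m∸n≤1+m∸[1+n] (suc m) zero    = ≤-refl
m∸n≤1+m∸[1+n] (suc m) (suc n) = m∸n≤1+m∸[1+n] m n

∣m-1+n∣≡1+∣m-n∣ : ∀ {m n} → m ≤ n → ∣ m - suc n ∣ ≡ suc ∣ m - n ∣
∣m-1+n∣≡1+∣m-n∣ z≤n       = refl
∣m-1+n∣≡1+∣m-n∣ (s≤s m≤n) = ∣m-1+n∣≡1+∣m-n∣ m≤n

∣m-n∣≡1+∣m-1+n∣ : ∀ {m n} → n < m → ∣ m - n ∣ ≡ suc ∣ m - suc n ∣
∣m-n∣≡1+∣m-1+n∣ {suc m} {zero}  _         = cong suc (sym (∣-∣-identityʳ m))
∣m-n∣≡1+∣m-1+n∣ {suc m} {suc n} (s≤s n<m) = ∣m-n∣≡1+∣m-1+n∣ n<m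

m*n≤o⇒m≤o/n : ∀ m n {o} .{{_ : NonZero n}} → m * n ≤ o → m ≤ o / n
m*n≤o⇒m≤o/n m n m*n≤o = subst (_≤ _) (m*n/n≡m m n) (/-monoˡ-≤ n m*n≤o)

sumTo : (ℕ → ℕ) → ℕ → ℕ
sumTo f zero    = 0
sumTo f (suc k) = sumTo f k + f k

module _ {f h : ℕ → ℕ} where

  sumTo-cong : ∀ k → (∀ i → i < k → f i ≡ h i) → sumTo f k ≡ sumTo h k
  sumTo-cong zero    _  = refl
  sumTo-cong (suc k) eq = cong₂ _+_ (sumTo-cong k (λ i → eq i ∘ m<n⇒m<1+n)) (eq k ≤-refl)

  sumTo-mono-≤ : ∀ k → (∀ i → i < k → f i ≤ h i) → sumTo f k ≤ sumTo h k
  sumTo-mono-≤ zero    _  = z≤n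
  sumTo-mono-≤ (suc k) le = +-mono-≤ (sumTo-mono-≤ k (λ i → le i ∘ m<n⇒m<1+n)) (le k ≤-refl)

sumTo-distrib-+ : ∀ f h k → sumTo (λ i → f i + h i) k ≡ sumTo f k + sumTo h k
sumTo-distrib-+ f h zero    = refl
sumTo-distrib-+ f h (suc k) =
  trans (cong (_+ (f k + h k)) (sumTo-distrib-+ f h k)) (interchange (sumTo f k) (sumTo h k) (f k) (h k))

sumTo-sucˡ : ∀ f k → sumTo f (suc k) ≡ f 0 + sumTo (f ∘ suc) k
sumTo-sucˡ f zero    = +-comm 0 (f 0)
sumTo-sucˡ f (suc k) = trans (cong (_+ f (suc k)) (sumTo-sucˡ f k)) (+-assoc (f 0) _ (f (suc k)))

sumTo-const : ∀ c k → sumTo (λ _ → c) k ≡ k * c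
sumTo-const c zero    = refl
sumTo-const c (suc k) = trans (cong (_+ c) (sumTo-const c k)) (+-comm (k * c) c)

module Cycle (m : ℕ) where

  next : ℕ → ℕ
  next i with suc i ≟ m
  ... | yes _ = 0
  ... | no  _ = suc i

  prev : ℕ → ℕ
  prev zero    = m ∸ 1
  prev (suc i) = i

  next-suc : ∀ {i} → suc i < m → next i ≡ suc i
  next-suc {i} i+1<m with suc i ≟ m
  ... | yes i+1≡m = contradiction i+1≡m (<⇒≢ i+1<m)
  ... | no  _     = refl

  next-last : ∀ {i} → suc i ≡ m → next i ≡ 0
  next-last {i} i+1≡m with suc i ≟ m
  ... | yes _     = refl
  ... | no  i+1≢m = contradiction i+1≡m i+1≢m

  next-cases : ∀ {i} → i < m → suc i ≡ m × next i ≡ 0 ⊎ next i ≡ suc i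
  next-cases {i} i<m with suc i ≟ m
  ... | yes i+1≡m = inj₁ (i+1≡m , refl)
  ... | no  _     = inj₂ refl

  next< : ∀ {i} → i < m → next i < m
  next< {i} i<m with suc i ≟ m
  ... | yes _     = ≤-<-trans z≤n i<m
  ... | no  i+1≢m = ≤∧≢⇒< i<m i+1≢m

  prev< : ∀ {i} → i < m → prev i < m
  prev< {zero}  0<m   = ∸-monoʳ-< {m} {1} {0} z<s 0<m
  prev< {suc i} i+1<m = <-trans (n<1+n i) i+1<m

  next-prev : ∀ {i} → i < m → next (prev i) ≡ i
  next-prev {zero}  0<m   = next-last (sym (+-∸-assoc 1 0<m))
  next-prev {suc i} i+1<m = next-suc i+1<m

  nextV prevV : Fin m → Fin m
  nextV v = fromℕ< (next< (toℕ<n v))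
  prevV v = fromℕ< (prev< (toℕ<n v))

  toℕ-nextV : ∀ v → toℕ (nextV v) ≡ next (toℕ v)
  toℕ-nextV v = toℕ-fromℕ< (next< (toℕ<n v))

  toℕ-prevV : ∀ v → toℕ (prevV v) ≡ prev (toℕ v)
  toℕ-prevV v = toℕ-fromℕ< (prev< (toℕ<n v))

sumTo-next : ∀ m f → sumTo (f ∘ Cycle.next m) m ≡ sumTo f m
sumTo-next zero    f = refl
sumTo-next (suc k) f = begin
  sumTo (f ∘ next) k + f (next k)  ≡⟨ cong₂ _+_ (sumTo-cong k (λ i i<k → cong f (next-suc (s≤s i<k))))
                                                (cong f (next-last refl)) ⟩
  sumTo (f ∘ suc) k + f 0          ≡⟨ +-comm _ (f 0) ⟩
  f 0 + sumTo (f ∘ suc) k          ≡⟨ sumTo-sucˡ f k ⟨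
  sumTo f (suc k)                  ∎
  where open Cycle (suc k); open ≡-Reasoning

sumTo-prev : ∀ m f → sumTo (f ∘ Cycle.prev m) m ≡ sumTo f m
sumTo-prev zero    f = refl
sumTo-prev (suc k) f = trans (sumTo-sucˡ (f ∘ Cycle.prev (suc k)) k) (+-comm (f k) (sumTo f k))

bit : Bool → ℕ
bit true  = 1
bit false = 0

bit+bit-not : ∀ b → bit b + bit (not b) ≡ 1
bit+bit-not true  = refl
bit+bit-not false = refl

bit-not : ∀ {b} → ¬ T b → bit (not b) ≡ 1
bit-not {false} _  = refl
bit-not {true}  ¬t = contradiction _ ¬t

module _ (m : ℕ) (a : ℕ → Bool) where
  open Cycle m

  3*ones≤2*length : (∀ i → i < m → T (a i) → ¬ T (a (next i)) ⊎ ¬ T (a (prev i))) →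
                    3 * sumTo (bit ∘ a) m ≤ 2 * m
  3*ones≤2*length lonely = begin
    3 * ones              ≡⟨⟩
    ones + 2 * ones       ≤⟨ +-monoˡ-≤ (2 * ones) ones≤2*zeros ⟩
    2 * zeros + 2 * ones  ≡⟨ *-distribˡ-+ 2 zeros ones ⟨
    2 * (zeros + ones)    ≡⟨ cong (2 *_) (trans (+-comm zeros ones) ones+zeros≡m) ⟩
    2 * m                 ∎
    where
    open ≤-Reasoning
    zero-at : ℕ → ℕ
    zero-at i = bit (not (a i))
    ones zeros : ℕ
    ones  = sumTo (bit ∘ a) m
    zeros = sumTo zero-at m

    ones+zeros≡m : ones + zeros ≡ m
    ones+zeros≡m = begin-equality
      ones + zeros                           ≡⟨ sumTo-distrib-+ (bit ∘ a) zero-at m ⟨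
      sumTo (λ i → bit (a i) + zero-at i) m  ≡⟨ sumTo-cong m (λ i _ → bit+bit-not (a i)) ⟩
      sumTo (λ _ → 1) m                      ≡⟨ sumTo-const 1 m ⟩
      m * 1                                  ≡⟨ *-identityʳ m ⟩
      m                                      ∎

    one≤zero-neighbours : ∀ i → i < m → bit (a i) ≤ zero-at (next i) + zero-at (prev i)
    one≤zero-neighbours i i<m with a i in ai
    ... | false = z≤n
    ... | true with lonely i i<m (subst T (sym ai) _)
    ...   | inj₁ ¬next = ≤-trans (≤-reflexive (sym (bit-not ¬next))) (m≤m+n _ _)
    ...   | inj₂ ¬prev = ≤-trans (≤-reflexive (sym (bit-not ¬prev))) (m≤n+m _ _)

    ones≤2*zeros : ones ≤ 2 * zeros
    ones≤2*zeros = begin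
      ones
        ≤⟨ sumTo-mono-≤ m one≤zero-neighbours ⟩
      sumTo (λ i → zero-at (next i) + zero-at (prev i)) m
        ≡⟨ sumTo-distrib-+ (zero-at ∘ next) (zero-at ∘ prev) m ⟩
      sumTo (zero-at ∘ next) m + sumTo (zero-at ∘ prev) m
        ≡⟨ cong₂ _+_ (sumTo-next m zero-at) (sumTo-prev m zero-at) ⟩
      zeros + zeros
        ≡⟨ cong (zeros +_) (+-identityʳ zeros) ⟨
      2 * zeros
        ∎

-- ℕ-indexed membership (false past the end), so that a subset is counted by sumTo.
memberAt : ∀ {k} → Subset k → ℕ → Bool
memberAt []      _       = false
memberAt (b ∷ p) zero    = b
memberAt (b ∷ p) (suc i) = memberAt p i

memberAt⇒∈ : ∀ {k} {p : Subset k} x → T (memberAt p (toℕ x)) → x ∈ₛ p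
memberAt⇒∈ {p = true ∷ _} zero    _ = here
memberAt⇒∈ {p = _ ∷ _}    (suc x) t = there (memberAt⇒∈ x t)

∣p∣≡sumTo-memberAt : ∀ {k} (p : Subset k) → ∣ p ∣ ≡ sumTo (bit ∘ memberAt p) k
∣p∣≡sumTo-memberAt []               = refl
∣p∣≡sumTo-memberAt {suc k} (true ∷ p)  =
  trans (cong suc (∣p∣≡sumTo-memberAt p)) (sym (sumTo-sucˡ (bit ∘ memberAt (true ∷ p)) k))
∣p∣≡sumTo-memberAt {suc k} (false ∷ p) =
  trans (∣p∣≡sumTo-memberAt p) (sym (sumTo-sucˡ (bit ∘ memberAt (false ∷ p)) k))

∀∈⇒∣p∣≡n : ∀ {k} {p : Subset k} → (∀ x → x ∈ₛ p) → ∣ p ∣ ≡ k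
∀∈⇒∣p∣≡n {k} all = trans (cong ∣_∣ (⊆-antisym ⊆⊤ (λ {x} _ → all x))) (∣⊤∣≡n k)

module _ {m} (p : Subset m) where
  open Cycle m

  3*∣p∣≤2*m : (∀ v → v ∈ₛ p → nextV v ∉ p ⊎ prevV v ∉ p) → 3 * ∣ p ∣ ≤ 2 * m
  3*∣p∣≤2*m lonely =
    subst (λ c → 3 * c ≤ 2 * m) (sym (∣p∣≡sumTo-memberAt p)) (3*ones≤2*length m (memberAt p) lonely-at)
    where
    lonely-at : ∀ i → i < m → T (memberAt p i) → ¬ T (memberAt p (next i)) ⊎ ¬ T (memberAt p (prev i))
    lonely-at i i<m = lonely-at-toℕ (fromℕ< i<m) (toℕ-fromℕ< i<m)
      where
      member : ∀ x {i} → toℕ x ≡ i → T (memberAt p i) → x ∈ₛ p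
      member x refl = memberAt⇒∈ x
      lonely-at-toℕ : ∀ v {i} → toℕ v ≡ i → T (memberAt p i) →
                      ¬ T (memberAt p (next i)) ⊎ ¬ T (memberAt p (prev i))
      lonely-at-toℕ v refl v∈p with lonely v (memberAt⇒∈ v v∈p)
      ... | inj₁ next∉p = inj₁ (next∉p ∘ member (nextV v) (toℕ-nextV v))
      ... | inj₂ prev∉p = inj₂ (prev∉p ∘ member (prevV v) (toℕ-prevV v))

module CyclicDistance (n : ℕ) where

  m : ℕ
  m = 2 * n

  open Cycle m public

  m≡n+n : m ≡ n + n
  m≡n+n = cong (n +_) (+-identityʳ n)

  arc : ℕ → ℕ
  arc x = x ⊓ (m ∸ x)

  arc-small : ∀ {x} → x ≤ n → arc x ≡ x
  arc-small {x} x≤n =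
    m≤n⇒m⊓n≡m (m+n≤o⇒m≤o∸n x (subst (x + x ≤_) (sym m≡n+n) (+-mono-≤ x≤n x≤n)))

  arc-large : ∀ {x} → n ≤ x → arc x ≡ m ∸ x
  arc-large {x} n≤x =
    m≥n⇒m⊓n≡n (m≤n+o⇒m∸n≤o m x (subst (_≤ x + x) (sym m≡n+n) (+-mono-≤ n≤x n≤x)))

  arc≤n : ∀ x → arc x ≤ n
  arc≤n x with ≤-total x n
  ... | inj₁ x≤n = ≤-trans (m⊓n≤m x _) x≤n
  ... | inj₂ n≤x =
    ≤-trans (m⊓n≤n x _) (m≤n+o⇒m∸n≤o m x (subst (_≤ x + n) (sym m≡n+n) (+-monoˡ-≤ n n≤x)))

  arc≡0⇒≡0 : ∀ {x} → x < m → arc x ≡ 0 → x ≡ 0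
  arc≡0⇒≡0 {x} x<m wx≡0 with ≤-total x n
  ... | inj₁ x≤n = trans (sym (arc-small x≤n)) wx≡0
  ... | inj₂ n≤x = contradiction (m∸n≡0⇒m≤n (trans (sym (arc-large n≤x)) wx≡0)) (<⇒≱ x<m)

  arc-reflect : ∀ {x} → x ≤ m → arc (m ∸ x) ≡ arc x
  arc-reflect {x} x≤m = trans (cong ((m ∸ x) ⊓_) (m∸[m∸n]≡n x≤m)) (⊓-comm (m ∸ x) x)

  arc-suc≤ : ∀ x → arc (suc x) ≤ suc (arc x)
  arc-suc≤ x = ⊓-monoʳ-≤ (suc x) (≤-trans (∸-monoʳ-≤ m (n≤1+n x)) (n≤1+n (m ∸ x)))

  arc-pred≤ : ∀ x → arc (pred x) ≤ suc (arc x)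
  arc-pred≤ zero    = n≤1+n _
  arc-pred≤ (suc x) = ⊓-mono-≤ (≤-trans (n≤1+n x) (n≤1+n (suc x))) (m∸n≤1+m∸[1+n] m x)

  arc-suc-small : ∀ {x} → x < n → arc (suc x) ≡ suc (arc x)
  arc-suc-small x<n = trans (arc-small x<n) (cong suc (sym (arc-small (<⇒≤ x<n))))

  arc-pred-small : ∀ {x} → x ≤ n → arc (pred x) ≡ pred (arc x)
  arc-pred-small x≤n = trans (arc-small (≤-trans pred[n]≤n x≤n)) (cong pred (sym (arc-small x≤n)))

  arc-suc-large : ∀ {x} → n ≤ x → arc (suc x) ≡ pred (arc x)
  arc-suc-large {x} n≤x = begin
    arc (suc x)      ≡⟨ arc-large (m≤n⇒m≤1+n n≤x) ⟩
    m ∸ suc x         ≡⟨ pred[m∸n]≡m∸[1+n] m x ⟨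
    pred (m ∸ x)      ≡⟨ cong pred (arc-large n≤x) ⟨
    pred (arc x)     ∎
    where open ≡-Reasoning

  arc-pred-large : ∀ {x} → n < x → x ≤ m → arc (pred x) ≡ suc (arc x)
  arc-pred-large {suc x} n<1+x 1+x≤m = begin
    arc x                 ≡⟨ arc-large (≤-pred n<1+x) ⟩
    m ∸ x                  ≡⟨ +-∸-assoc 1 1+x≤m ⟩
    suc (m ∸ suc x)        ≡⟨ cong suc (arc-large (≤-pred (m≤n⇒m≤1+n n<1+x))) ⟨
    suc (arc (suc x))     ∎
    where open ≡-Reasoning

  cdist : ℕ → ℕ → ℕ
  cdist u v = arc ∣ u - v ∣

  cdist-refl : ∀ u → cdist u u ≡ 0
  cdist-refl u = cong arc (∣n-n∣≡0 u)

  cdist-sym : ∀ u v → cdist u v ≡ cdist v u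
  cdist-sym u v = cong arc (∣-∣-comm u v)

  cdist≤n : ∀ u v → cdist u v ≤ n
  cdist≤n u v = arc≤n ∣ u - v ∣

  ∣-∣<m : ∀ {u v} → u < m → v < m → ∣ u - v ∣ < m
  ∣-∣<m {u} {v} u<m v<m = ≤-<-trans (∣m-n∣≤m⊔n u v) (⊔-lub u<m v<m)

  cdist≡0⇒≡ : ∀ {u v} → u < m → v < m → cdist u v ≡ 0 → u ≡ v
  cdist≡0⇒≡ u<m v<m d≡0 = ∣m-n∣≡0⇒m≡n (arc≡0⇒≡0 (∣-∣<m u<m v<m) d≡0)

  cdist-next-away : ∀ {u v} → u ≤ v → v < m → cdist u (next v) ≡ arc (suc ∣ u - v ∣)
  cdist-next-away {u} {v} u≤v v<m with suc v ≟ m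
  ... | no  _     = cong arc (∣m-1+n∣≡1+∣m-n∣ u≤v)
  ... | yes v+1≡m = begin
    arc ∣ u - 0 ∣       ≡⟨ cong arc (∣-∣-identityʳ u) ⟩
    arc u               ≡⟨ arc-reflect (≤-trans u≤v (<⇒≤ v<m)) ⟨
    arc (m ∸ u)         ≡⟨ cong (λ k → arc (k ∸ u)) v+1≡m ⟨
    arc (suc v ∸ u)     ≡⟨ cong arc (+-∸-assoc 1 u≤v) ⟩
    arc (suc (v ∸ u))   ≡⟨ cong (arc ∘ suc) (m≤n⇒∣m-n∣≡n∸m u≤v) ⟨
    arc (suc ∣ u - v ∣) ∎
    where open ≡-Reasoning

  cdist-next-toward : ∀ {u v} → v < u → u < m → cdist u (next v) ≡ arc (pred ∣ u - v ∣)
  cdist-next-toward {u} {v} v<u u<m =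
    trans (cong (cdist u) (next-suc (≤-<-trans v<u u<m))) (cong (arc ∘ pred) (sym (∣m-n∣≡1+∣m-1+n∣ v<u)))

  cdist-prev-away : ∀ {u v} → v ≤ u → u < m → cdist u (prev v) ≡ arc (suc ∣ u - v ∣)
  cdist-prev-away {u} {zero} _ u<m = begin
    arc ∣ u - (m ∸ 1) ∣   ≡⟨ cong arc (m≤n⇒∣m-n∣≡n∸m u≤m-1) ⟩
    arc (m ∸ 1 ∸ u)       ≡⟨ cong arc (∸-+-assoc m 1 u) ⟩
    arc (m ∸ suc u)       ≡⟨ arc-reflect u<m ⟩
    arc (suc u)           ≡⟨ cong (arc ∘ suc) (∣-∣-identityʳ u) ⟨
    arc (suc ∣ u - 0 ∣)   ∎
    where
    open ≡-Reasoning
    u≤m-1 : u ≤ m ∸ 1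
    u≤m-1 = m+n≤o⇒m≤o∸n u (subst (_≤ m) (+-comm 1 u) u<m)
  cdist-prev-away {u} {suc v} v<u _ = cong arc (∣m-n∣≡1+∣m-1+n∣ v<u)

  cdist-prev-toward : ∀ {u v} → u < v → cdist u (prev v) ≡ arc (pred ∣ u - v ∣)
  cdist-prev-toward {u} {suc v} (s≤s u≤v) = cong (arc ∘ pred) (sym (∣m-1+n∣≡1+∣m-n∣ u≤v))

  farther-neighbour : ∀ {u v} → u < m → v < m →
    cdist u (next v) ≡ arc (suc ∣ u - v ∣) ⊎ cdist u (prev v) ≡ arc (suc ∣ u - v ∣)
  farther-neighbour {u} {v} u<m v<m with ≤-total u v
  ... | inj₁ u≤v = inj₁ (cdist-next-away u≤v v<m)
  ... | inj₂ v≤u = inj₂ (cdist-prev-away v≤u u<m)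

  closer-neighbour : ∀ {u v} → u < m → u ≢ v →
    cdist u (next v) ≡ arc (pred ∣ u - v ∣) ⊎ cdist u (prev v) ≡ arc (pred ∣ u - v ∣)
  closer-neighbour {u} {v} u<m u≢v with <-cmp u v
  ... | tri< u<v _ _ = inj₂ (cdist-prev-toward u<v)
  ... | tri≈ _ u≡v _ = contradiction u≡v u≢v
  ... | tri> _ _ v<u = inj₁ (cdist-next-toward v<u u<m)

  cdist-next≤ : ∀ {u v} → u < m → v < m → cdist u (next v) ≤ suc (cdist u v)
  cdist-next≤ {u} {v} u<m v<m with ≤-<-connex u v
  ... | inj₁ u≤v = ≤-trans (≤-reflexive (cdist-next-away u≤v v<m)) (arc-suc≤ ∣ u - v ∣)
  ... | inj₂ v<u = ≤-trans (≤-reflexive (cdist-next-toward v<u u<m)) (arc-pred≤ ∣ u - v ∣)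

  cdist-prev≤ : ∀ {u v} → u < m → v < m → cdist u (prev v) ≤ suc (cdist u v)
  cdist-prev≤ {u} {v} u<m v<m with <-≤-connex u v
  ... | inj₁ u<v = ≤-trans (≤-reflexive (cdist-prev-toward u<v)) (arc-pred≤ ∣ u - v ∣)
  ... | inj₂ v≤u = ≤-trans (≤-reflexive (cdist-prev-away v≤u u<m)) (arc-suc≤ ∣ u - v ∣)

  cdist-ascent : ∀ {u v} → u < m → v < m → cdist u v < n →
    cdist u (next v) ≡ suc (cdist u v) ⊎ cdist u (prev v) ≡ suc (cdist u v)
  cdist-ascent {u} {v} u<m v<m d<n with ∣ u - v ∣ ≤? n
  ... | yes a≤n = Sum.map (λ e → trans e step) (λ e → trans e step) (farther-neighbour u<m v<m)
    where step = arc-suc-small (subst (_< n) (arc-small a≤n) d<n)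
  ... | no  a≰n = Sum.map (λ e → trans e step) (λ e → trans e step) (closer-neighbour u<m u≢v)
    where
    n<a : n < ∣ u - v ∣
    n<a = ≰⇒> a≰n
    step = arc-pred-large n<a (<⇒≤ (∣-∣<m u<m v<m))
    u≢v : u ≢ v
    u≢v refl = contradiction (subst (n <_) (∣n-n∣≡0 u) n<a) λ ()

  cdist-descent : ∀ {u v k} → u < m → v < m → cdist u v ≡ suc k →
    cdist u (next v) ≡ k ⊎ cdist u (prev v) ≡ k
  cdist-descent {u} {v} u<m v<m d≡1+k with ∣ u - v ∣ ≤? n
  ... | yes a≤n = Sum.map (λ e → trans e step) (λ e → trans e step) (closer-neighbour u<m u≢v)
    where
    step = trans (arc-pred-small a≤n) (cong pred d≡1+k)
    u≢v : u ≢ v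
    u≢v refl = contradiction (trans (sym (cdist-refl u)) d≡1+k) λ ()
  ... | no  a≰n = Sum.map (λ e → trans e step) (λ e → trans e step) (farther-neighbour u<m v<m)
    where step = trans (arc-suc-large (<⇒≤ (≰⇒> a≰n))) (cong pred d≡1+k)

module _ {N} (G : Graph N) where
  open Equivalence

  reach-zero⇔ : ∀ {u v} → T (reach G 0 u v) ⇔ u ≡ v
  reach-zero⇔ = mk⇔ toWitness fromWitness

  reach-suc⁺ : ∀ {k u v} → T (reach G k u v) ⊎ ∃[ w ] T (reach G k u w) × T (G w v) →
               T (reach G (suc k) u v)
  reach-suc⁺ (inj₁ r)           = from T-∨ (inj₁ r)
  reach-suc⁺ (inj₂ (w , r , a)) = from T-∨ (inj₂ (any⁺ _ (lose (∈-allFin w) (from T-∧ (r , a)))))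

  reach-suc⁻ : ∀ {k u v} → T (reach G (suc k) u v) →
               T (reach G k u v) ⊎ ∃[ w ] T (reach G k u w) × T (G w v)
  reach-suc⁻ {k} {u} {v} r = Sum.map₂ split (to T-∨ r)
    where
    step-to-v : Fin N → Bool
    step-to-v w = reach G k u w ∧ G w v
    split : T (any step-to-v (allFin N)) → ∃[ w ] T (reach G k u w) × T (G w v)
    split some-w = let w , r∧a = satisfied (any⁻ step-to-v (allFin N) some-w) in w , to T-∧ r∧a

  distFrom-exact : ∀ {u v c} → (∀ k → T (reach G k u v) ⇔ c ≤ k) →
                   ∀ fuel k → k ≤ c → c ≤ k + fuel → distFrom G k fuel u v ≡ c
  distFrom-exact {c = c} spec zero k k≤c c≤k+0 = ≤-antisym k≤c (subst (c ≤_) (+-identityʳ k) c≤k+0)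
  distFrom-exact {u} {v} {c} spec (suc fuel) k k≤c c≤k+1+fuel with reach G k u v in reached
  ... | true  = ≤-antisym k≤c (to (spec k) (subst T (sym reached) _))
  ... | false = distFrom-exact spec fuel (suc k) k<c (subst (c ≤_) (+-suc k fuel) c≤k+1+fuel)
    where
    k<c : k < c
    k<c = ≰⇒> (λ c≤k → subst T reached (from (spec k) c≤k))

  dist-exact : ∀ {u v c} → c ≤ N → (∀ k → T (reach G k u v) ⇔ c ≤ k) → dist G u v ≡ c
  dist-exact c≤N spec = distFrom-exact spec _ 0 z≤n c≤N

module _ {A : Set} (h : A → ℕ) where

  foldr-⊔-lub : ∀ {b} → (∀ x → h x ≤ b) → ∀ xs → foldr (λ y r → h y ⊔ r) 0 xs ≤ b
  foldr-⊔-lub bound []       = z≤n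
  foldr-⊔-lub bound (x ∷ xs) = ⊔-lub (bound x) (foldr-⊔-lub bound xs)

  ≤-foldr-⊔ : ∀ {x xs} → x ∈ xs → h x ≤ foldr (λ y r → h y ⊔ r) 0 xs
  ≤-foldr-⊔ (here refl)  = m≤m⊔n _ _
  ≤-foldr-⊔ {xs = y ∷ _} (there x∈xs) = ≤-trans (≤-foldr-⊔ x∈xs) (m≤n⊔m (h y) _)

  foldr-⊔-attained : ∀ {x xs} → x ∈ xs → ∃[ w ] w ∈ xs × foldr (λ y r → h y ⊔ r) 0 xs ≡ h w
  foldr-⊔-attained {xs = y ∷ ys} _ = attained y ys
    where
    attained : ∀ y ys → ∃[ w ] w ∈ y ∷ ys × foldr (λ x r → h x ⊔ r) 0 (y ∷ ys) ≡ h w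
    attained y []       = y , here refl , ⊔-identityʳ (h y)
    attained y (z ∷ zs) with attained z zs | ≤-total (h y) (foldr (λ x r → h x ⊔ r) 0 (z ∷ zs))
    ... | w , w∈zs , eq | inj₁ hy≤ = w , there w∈zs , trans (m≤n⇒m⊔n≡n hy≤) eq
    ... | _             | inj₂ hy≥ = y , here refl , m≥n⇒m⊔n≡m hy≥

module _ {N} (G : Graph N) (S : Subset N) (v : Fin N) where

  ecc-lub : ∀ {b} → (∀ x → dist G v x ≤ b) → ecc G S v ≤ b
  ecc-lub bound = foldr-⊔-lub (dist G v) bound (filter (_∈? S) (allFin N))

  dist≤ecc : ∀ {x} → x ∈ₛ S → dist G v x ≤ ecc G S v
  dist≤ecc x∈S = ≤-foldr-⊔ (dist G v) (∈-filter⁺ (_∈? S) (∈-allFin _) x∈S)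

  ecc-attained : Nonempty S → ∃[ y ] y ∈ₛ S × ecc G S v ≡ dist G v y
  ecc-attained (x , x∈S) with foldr-⊔-attained (dist G v) (∈-filter⁺ (_∈? S) (∈-allFin x) x∈S)
  ... | y , y∈members , eq = y , proj₂ (∈-filter⁻ (_∈? S) {xs = allFin N} y∈members) , eq

cycleGraph-sym : ∀ m i j → cycleGraph m i j ≡ cycleGraph m j i
cycleGraph-sym m i j = begin
  a ∨ (b ∨ (c ∨ d))   ≡⟨ ∨-assoc a b (c ∨ d) ⟨
  (a ∨ b) ∨ (c ∨ d)   ≡⟨ cong₂ _∨_ (∨-comm a b) (∨-comm c d) ⟩
  (b ∨ a) ∨ (d ∨ c)   ≡⟨ ∨-assoc b a (d ∨ c) ⟩
  b ∨ (a ∨ (d ∨ c))   ∎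
  where
  open ≡-Reasoning
  a = ⌊ toℕ j ≟ suc (toℕ i) ⌋
  b = ⌊ toℕ i ≟ suc (toℕ j) ⌋
  c = ⌊ suc (toℕ i) ≟ m ⌋ ∧ ⌊ toℕ j ≟ 0 ⌋
  d = ⌊ suc (toℕ j) ≟ m ⌋ ∧ ⌊ toℕ i ≟ 0 ⌋

module _ {m} {i j : Fin m} where
  open Equivalence
  private
    forward backward forward-wraparound : Bool
    forward            = ⌊ toℕ j ≟ suc (toℕ i) ⌋
    backward           = ⌊ toℕ i ≟ suc (toℕ j) ⌋
    forward-wraparound = ⌊ suc (toℕ i) ≟ m ⌋ ∧ ⌊ toℕ j ≟ 0 ⌋

  cycleGraph-suc : toℕ j ≡ suc (toℕ i) → T (cycleGraph m i j)
  cycleGraph-suc j≡i+1 = from (T-∨ {forward}) (inj₁ (fromWitness j≡i+1))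

  cycleGraph-wraparound : suc (toℕ i) ≡ m → toℕ j ≡ 0 → T (cycleGraph m i j)
  cycleGraph-wraparound i+1≡m j≡0 =
    from (T-∨ {forward}) (inj₂ (from (T-∨ {backward}) (inj₂ (from (T-∨ {forward-wraparound}) (inj₁
      (from (T-∧ {⌊ suc (toℕ i) ≟ m ⌋}) (fromWitness i+1≡m , fromWitness j≡0)))))))

  cycleGraph-cases : T (cycleGraph m i j) →
    toℕ j ≡ suc (toℕ i) ⊎ toℕ i ≡ suc (toℕ j) ⊎
    suc (toℕ i) ≡ m × toℕ j ≡ 0 ⊎ suc (toℕ j) ≡ m × toℕ i ≡ 0
  cycleGraph-cases adj with to (T-∨ {forward}) adj
  ... | inj₁ j≡i+1 = inj₁ (toWitness j≡i+1)
  ... | inj₂ adj′ with to (T-∨ {backward}) adj′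
  ...   | inj₁ i≡j+1 = inj₂ (inj₁ (toWitness i≡j+1))
  ...   | inj₂ adj″ = inj₂ (inj₂ (Sum.map (witnesses {suc (toℕ i)} {m} {toℕ j})
                                              (witnesses {suc (toℕ j)} {m} {toℕ i})
                                              (to (T-∨ {forward-wraparound}) adj″)))
    where
    witnesses : ∀ {a b c} → T (⌊ a ≟ b ⌋ ∧ ⌊ c ≟ 0 ⌋) → a ≡ b × c ≡ 0
    witnesses {a} {b} both = let p , q = to (T-∧ {⌊ a ≟ b ⌋}) both in toWitness p , toWitness q

module CycleGraph (n : ℕ) where
  open CyclicDistance n public
  open Equivalence

  G : Graph m
  G = cycleGraph m

  adjacent⇒ : ∀ {w v} → T (G w v) → toℕ v ≡ next (toℕ w) ⊎ toℕ v ≡ prev (toℕ w)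
  adjacent⇒ {w} {v} adj with cycleGraph-cases adj
  ... | inj₁ v≡w+1 = inj₁ (trans v≡w+1 (sym (next-suc (subst (_< m) v≡w+1 (toℕ<n v)))))
  ... | inj₂ (inj₁ w≡v+1) = inj₂ (sym (cong prev w≡v+1))
  ... | inj₂ (inj₂ (inj₁ (w+1≡m , v≡0))) = inj₁ (trans v≡0 (sym (next-last w+1≡m)))
  ... | inj₂ (inj₂ (inj₂ (v+1≡m , w≡0))) = inj₂ (trans (cong (_∸ 1) v+1≡m) (cong prev (sym w≡0)))

  next-adjacent : ∀ {w v} → toℕ v ≡ next (toℕ w) → T (G w v)
  next-adjacent {w} {v} v≡next-w with next-cases (toℕ<n w)
  ... | inj₁ (w+1≡m , next-w≡0) = cycleGraph-wraparound w+1≡m (trans v≡next-w next-w≡0)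
  ... | inj₂ next-w≡w+1         = cycleGraph-suc (trans v≡next-w next-w≡w+1)

  adjacent-sym : ∀ v w → T (G v w) → T (G w v)
  adjacent-sym v w = subst T (cycleGraph-sym m v w)

  adjacent-nextV : ∀ v → T (G v (nextV v))
  adjacent-nextV v = next-adjacent (toℕ-nextV v)

  adjacent-prevV : ∀ v → T (G v (prevV v))
  adjacent-prevV v = adjacent-sym (prevV v) v (next-adjacent (begin
    toℕ v                 ≡⟨ next-prev (toℕ<n v) ⟨
    next (prev (toℕ v))   ≡⟨ cong next (toℕ-prevV v) ⟨
    next (toℕ (prevV v))  ∎))
    where open ≡-Reasoning

  cdist-adjacent≤ : ∀ {u} w v → T (G w v) → cdist (toℕ u) (toℕ v) ≤ suc (cdist (toℕ u) (toℕ w))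
  cdist-adjacent≤ {u} w v adj with adjacent⇒ adj
  ... | inj₁ v≡next-w = subst (λ x → cdist (toℕ u) x ≤ _) (sym v≡next-w) (cdist-next≤ (toℕ<n u) (toℕ<n w))
  ... | inj₂ v≡prev-w = subst (λ x → cdist (toℕ u) x ≤ _) (sym v≡prev-w) (cdist-prev≤ (toℕ<n u) (toℕ<n w))

  closer-adjacent : ∀ {u v k} → cdist (toℕ u) (toℕ v) ≡ suc k →
                    ∃[ w ] T (G w v) × cdist (toℕ u) (toℕ w) ≡ k
  closer-adjacent {u} {v} d≡1+k with cdist-descent (toℕ<n u) (toℕ<n v) d≡1+k
  ... | inj₁ d≡k = nextV v , adjacent-sym v (nextV v) (adjacent-nextV v) ,
                   trans (cong (cdist (toℕ u)) (toℕ-nextV v)) d≡k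
  ... | inj₂ d≡k = prevV v , adjacent-sym v (prevV v) (adjacent-prevV v) ,
                   trans (cong (cdist (toℕ u)) (toℕ-prevV v)) d≡k

  reach⇔cdist≤ : ∀ k u v → T (reach G k u v) ⇔ cdist (toℕ u) (toℕ v) ≤ k
  reach⇔cdist≤ zero u v = mk⇔ bounded reached
    where
    bounded : T (reach G 0 u v) → cdist (toℕ u) (toℕ v) ≤ 0
    bounded r with to (reach-zero⇔ G {u} {v}) r
    ... | refl = ≤-reflexive (cdist-refl (toℕ u))
    reached : cdist (toℕ u) (toℕ v) ≤ 0 → T (reach G 0 u v)
    reached d≤0 =
      from (reach-zero⇔ G {u} {v}) (toℕ-injective (cdist≡0⇒≡ (toℕ<n u) (toℕ<n v) (n≤0⇒n≡0 d≤0)))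
  reach⇔cdist≤ (suc k) u v = mk⇔ bounded reached
    where
    bounded : T (reach G (suc k) u v) → cdist (toℕ u) (toℕ v) ≤ suc k
    bounded r with reach-suc⁻ G {k} {u} {v} r
    ... | inj₁ r′            = m≤n⇒m≤1+n (to (reach⇔cdist≤ k u v) r′)
    ... | inj₂ (w , r′ , adj) = ≤-trans (cdist-adjacent≤ {u} w v adj) (s≤s (to (reach⇔cdist≤ k u w) r′))
    reached : cdist (toℕ u) (toℕ v) ≤ suc k → T (reach G (suc k) u v)
    reached d≤1+k with m≤n⇒m<n∨m≡n d≤1+k
    ... | inj₁ (s≤s d≤k) = reach-suc⁺ G {k} {u} {v} (inj₁ (from (reach⇔cdist≤ k u v) d≤k))
    ... | inj₂ d≡1+k with closer-adjacent {u} {v} d≡1+k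
    ...   | w , adj , d≡k =
      reach-suc⁺ G {k} {u} {v} (inj₂ (w , from (reach⇔cdist≤ k u w) (≤-reflexive d≡k) , adj))

  dist≡cdist : ∀ u v → dist G u v ≡ cdist (toℕ u) (toℕ v)
  dist≡cdist u v = dist-exact G (≤-trans (cdist≤n (toℕ u) (toℕ v)) (m≤m+n n _)) (λ k → reach⇔cdist≤ k u v)

  ecc≤n : ∀ S v → ecc G S v ≤ n
  ecc≤n S v = ecc-lub G S v (λ x → subst (_≤ n) (sym (dist≡cdist v x)) (cdist≤n (toℕ v) (toℕ x)))

  ecc-ascent : ∀ {S} → Nonempty S → ∀ v → ecc G S v < n →
               ecc G S v < ecc G S (nextV v) ⊎ ecc G S v < ecc G S (prevV v)
  ecc-ascent {S} S≢∅ v e<n with ecc-attained G S v S≢∅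
  ... | y , y∈S , e≡dist = Sum.map (farther⇒ecc< (nextV v) (toℕ-nextV v)) (farther⇒ecc< (prevV v) (toℕ-prevV v))
                              (cdist-ascent (toℕ<n y) (toℕ<n v) (subst (_< n) e≡cdist e<n))
    where
    e≡cdist : ecc G S v ≡ cdist (toℕ y) (toℕ v)
    e≡cdist = trans e≡dist (trans (dist≡cdist v y) (cdist-sym (toℕ v) (toℕ y)))
    farther⇒ecc< : ∀ w {x} → toℕ w ≡ x → cdist (toℕ y) x ≡ suc (cdist (toℕ y) (toℕ v)) →
                   ecc G S v < ecc G S w
    farther⇒ecc< w refl d≡1+e = begin
      suc (ecc G S v)                 ≡⟨ cong suc e≡cdist ⟩
      suc (cdist (toℕ y) (toℕ v))     ≡⟨ d≡1+e ⟨
      cdist (toℕ y) (toℕ w)           ≡⟨ cdist-sym (toℕ y) (toℕ w) ⟩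
      cdist (toℕ w) (toℕ y)           ≡⟨ dist≡cdist w y ⟨
      dist G w y                      ≤⟨ dist≤ecc G S w y∈S ⟩
      ecc G S w                       ∎
      where open ≤-Reasoning

module _ (n : ℕ) {S : Subset (2 * n)} where
  open CycleGraph n
  open Equivalence

  everyone-central : (∀ v → n ≤ ecc G S v) → ∀ v → InCenter G S v
  everyone-central ecc≥n v x = ≤-trans (ecc≤n S v) (ecc≥n x)

  center-members-lonely : ∀ {A v₀} → (∀ v → (v ∈ₛ A) ⇔ InCenter G S v) →
                          Nonempty S → ecc G S v₀ < n →
                          ∀ v → v ∈ₛ A → nextV v ∉ A ⊎ prevV v ∉ A
  center-members-lonely {A} {v₀} A≡center S≢∅ small v v∈A =
    Sum.map (not-member (nextV v)) (not-member (prevV v))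
            (ecc-ascent S≢∅ v (≤-<-trans (to (A≡center v) v∈A v₀) small))
    where
    not-member : ∀ w → ecc G S v < ecc G S w → w ∉ A
    not-member w v<w w∈A = <⇒≱ v<w (to (A≡center w) w∈A v)

mainTheorem12 : (n : ℕ) → 2 ≤ n → (A : Subset (2 * n)) →
    IsCenterSet (cycleGraph (2 * n)) A →
    (∣ A ∣ ≤ (4 * n) / 3) ⊎ (∣ A ∣ ≡ 2 * n)
mainTheorem12 n _ A (S , S≢∅ , A≡center) with any? (λ v → ecc (cycleGraph (2 * n)) S v <? n)
... | no  no-small = inj₂ (∀∈⇒∣p∣≡n (λ v → Equivalence.from (A≡center v)
                       (everyone-central n (λ x → ≮⇒≥ (no-small ∘ (x ,_))) v)))
... | yes (_ , small) = inj₁ (m*n≤o⇒m≤o/n ∣ A ∣ 3 (subst₂ _≤_ (*-comm 3 ∣ A ∣) (sym (*-assoc 2 2 n))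
                          (3*∣p∣≤2*m A (center-members-lonely n A≡center S≢∅ small))))
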